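{- For all $n\geq1$ and $\sigma\in\{231,312\}$, $j_n(\{213,\sigma\})=2^{\lfloor (n-1)/2\rfloor}$.
   Context: A permutation of a finite set $S$ of positive integers is a word in which each element of $S$ appears exactly once; $\mathfrak{S}_n$ is the set of permutations of $\{1,\dots,n\}$. For a permutation $\pi$ and a letter $x$ of $\pi$, $\rho_\pi(x)$ is the maximal consecutive subword of $\pi$ consisting of the letters immediately to the right of $x$ that are all larger than $x$. $\pi$ is Jacobi if $|\rho_\pi(x)|$ is even for all letters $x$. A permutation $\pi$ avoids a pattern $\sigma$ if no subword of $\pi$ has standardization (relative order) $\sigma$. For a set $\Pi$ of patterns, $j_n(\Pi)$ is the number of Jacobi permutations in $\mathfrak{S}_n$ avoiding every pattern in $\Pi$. -}

module Defs where

open import Data.Nat using (ℕ; suc; _<_; _<?_; _*_)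
open import Data.Fin using (Fin; cast)
open import Data.List using (List; []; _∷_; length; lookup; takeWhile; upTo; map)
open import Data.List.Relation.Binary.Sublist.Propositional using (_⊆_)
open import Data.List.Relation.Binary.Permutation.Propositional using (_↭_)
open import Data.List.Membership.Propositional using (_∈_)
open import Data.List.Relation.Unary.Unique.Propositional using (Unique)
open import Data.Product using (Σ; ∃; _×_)
open import Data.Unit using (⊤)
open import Function.Bundles using (_⇔_)
open import Relation.Nullary using (¬_)
open import Relation.Binary.PropositionalEquality using (_≡_)

oneTo : ℕ → List ℕ
oneTo n = map suc (upTo n)

IsPerm : ℕ → List ℕ → Set
IsPerm n π = π ↭ oneTo n

Even : ℕ → Set
Even m = ∃ λ k → m ≡ 2 * k

-- ρ_π(x) for the letter x heading the suffix x ∷ rest: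
-- the maximal run of letters immediately right of x that are larger than x
ρ : ℕ → List ℕ → List ℕ
ρ x rest = takeWhile (x <?_) rest

Jacobi : List ℕ → Set
Jacobi [] = ⊤
Jacobi (x ∷ xs) = Even (length (ρ x xs)) × Jacobi xs

SameOrder : List ℕ → List ℕ → Set
SameOrder w σ = Σ (length w ≡ length σ) λ eq →
  ∀ i j → (lookup w i < lookup w j) ⇔ (lookup σ (cast eq i) < lookup σ (cast eq j))

Contains : List ℕ → List ℕ → Set
Contains π σ = ∃ λ w → w ⊆ π × SameOrder w σ

Avoids : List ℕ → List ℕ → Set
Avoids π σ = ¬ Contains π σ

HasCount : (List ℕ → Set) → ℕ → Set
HasCount P m = Σ (List (List ℕ)) λ L →
  Unique L × (∀ π → (π ∈ L) ⇔ P π) × (length L ≡ m)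

JacobiAvoiding2 : ℕ → List ℕ → List ℕ → List ℕ → Set
JacobiAvoiding2 n τ σ π = IsPerm n π × Jacobi π × Avoids π τ × Avoids π σ

{-# OPTIONS --safe #-}
module Submission where

-- Write a(k) for the number of Jacobi permutations of an interval of k + 1 consecutive integers
-- that avoid 213 and σ.  For σ = 231 the first letter of such a permutation is its minimum or its
-- maximum: otherwise the minimum and the maximum both follow it, in an order producing 213 or 231.
-- For σ = 312 the minimum is the first or the last letter: otherwise the first letter and the
-- letter following the minimum form 213 or 312 with it.  Deleting that extreme letter leaves a
-- permutation of the same kind of a smaller interval, and the Jacobi condition only sees the
-- deletion when the minimum comes first, where ρ of it is the whole remainder and must have even
-- length.  So a(k + 1) = a(k) + [k + 1 even] a(k), and a(k) = 2 ^ ⌊k/2⌋.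

open import Defs
open import Level using (Level)
open import Data.Nat using (ℕ; zero; suc; _+_; _^_; _∸_; _<_; _≤_; _≥_; z≤n; s≤s; z<s; s<s; ⌊_/2⌋)
open import Data.Nat.Properties
open import Data.Nat.DivMod using (_/_; m/n≡1+[m∸n]/n)
open import Data.Fin using (#_; zero; suc; cast)
open import Data.List using (List; []; _∷_; _++_; [_]; length; lookup; map; applyUpTo; takeWhile)
open import Data.List.Properties using (length-map; length-++; map-applyUpTo; ++-cancelʳ; ∷-injectiveˡ; ∷-injectiveʳ)
open import Data.List.Membership.Propositional using (_∈_)
open import Data.List.Membership.Propositional.Properties using (∈-map⁺; ∈-map⁻; ++-∈⇔; ∈-∃++; ∈-++⁺ʳ)
open import Data.List.Relation.Unary.All as All using (All; []; _∷_)
open import Data.List.Relation.Unary.Any using (here; there; tail)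
open import Data.List.Relation.Unary.Unique.Propositional using (Unique; []; _∷_)
import Data.List.Relation.Unary.Unique.Propositional.Properties as Unique
open import Data.List.Relation.Binary.Permutation.Propositional using (_↭_; prep; ↭-refl; ↭-sym; ↭-trans; ↭⇒↭ₛ)
open import Data.List.Relation.Binary.Permutation.Propositional.Properties
  using (∈-resp-↭; ↭-length; ↭-singleton-inv; drop-mid; drop-∷; ∷↭∷ʳ)
import Data.List.Relation.Binary.Permutation.Setoid.Properties as Permutation
open import Data.List.Relation.Binary.Sublist.Propositional using (_⊆_; []; _∷_; _∷ʳ_; ⊆-refl; ⊆-trans; from∈)
import Data.List.Relation.Binary.Sublist.Propositional as Sublist
open import Data.List.Relation.Binary.Sublist.Propositional.Properties using (length-mono-≤; ++⁺ˡ; ++⁺ʳ; []⊆-universal)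
open import Data.Product using (∃; _×_; _,_; proj₁; proj₂)
open import Data.Product.Function.NonDependent.Propositional using (_×-⇔_)
open import Data.Sum using (_⊎_; inj₁; inj₂; map₂)
import Data.Sum
open import Data.Sum.Function.Propositional using (_⊎-⇔_)
open import Function using (id; _∘_; case_of_)
open import Function.Bundles using (_⇔_; mk⇔; Equivalence)
open import Function.Construct.Composition using (_⇔-∘_)
open import Function.Construct.Symmetry using (⇔-sym)
open import Relation.Nullary using (¬_; contradiction; yes; no)
open import Relation.Unary using (Decidable)
open import Relation.Binary.Definitions using (tri<; tri≈; tri>)
open import Relation.Binary.PropositionalEquality
  using (_≡_; _≢_; refl; sym; trans; cong; cong₂; subst; subst₂; setoid)

-- Intervals

range : ℕ → ℕ → List ℕ
range lo zero = []
range lo (suc k) = lo ∷ range (suc lo) k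

∈-range⁻ : ∀ lo k {z} → z ∈ range lo k → lo ≤ z × z < lo + k
∈-range⁻ lo (suc k) (here refl) = ≤-refl , m<m+n lo z<s
∈-range⁻ lo (suc k) {z} (there z∈) =
  let lo<z , z<hi = ∈-range⁻ (suc lo) k z∈ in <⇒≤ lo<z , subst (z <_) (sym (+-suc lo k)) z<hi

length-range : ∀ lo k → length (range lo k) ≡ k
length-range lo zero = refl
length-range lo (suc k) = cong suc (length-range (suc lo) k)

range-unique : ∀ lo k → Unique (range lo k)
range-unique lo zero = []
range-unique lo (suc k) = All.tabulate (<⇒≢ ∘ proj₁ ∘ ∈-range⁻ (suc lo) k) ∷ range-unique (suc lo) k

range-snoc : ∀ lo k → range lo (suc k) ≡ range lo k ++ [ lo + k ]
range-snoc lo zero = cong [_] (sym (+-identityʳ lo))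
range-snoc lo (suc k) =
  cong (lo ∷_) (trans (range-snoc (suc lo) k) (cong (λ hi → range (suc lo) k ++ [ hi ]) (sym (+-suc lo k))))

range-suc↭ : ∀ lo k → range lo (suc k) ↭ (lo + k) ∷ range lo k
range-suc↭ lo k =
  subst (_↭ (lo + k) ∷ range lo k) (sym (range-snoc lo k)) (↭-sym (∷↭∷ʳ (lo + k) (range lo k)))

module _ {w lo k} (w↭ : w ↭ range lo k) where

  ∈-↭-range⁻ : ∀ {z} → z ∈ w → lo ≤ z × z < lo + k
  ∈-↭-range⁻ = ∈-range⁻ lo k ∘ ∈-resp-↭ w↭

  ↭-range-lower : All (lo ≤_) w
  ↭-range-lower = All.tabulate (proj₁ ∘ ∈-↭-range⁻)

  ↭-range-upper : All (_< lo + k) w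
  ↭-range-upper = All.tabulate (proj₂ ∘ ∈-↭-range⁻)

  length-↭-range : length w ≡ k
  length-↭-range = trans (↭-length w↭) (length-range lo k)

  unique-↭-range : Unique w
  unique-↭-range = Permutation.Unique-resp-↭ (setoid ℕ) (↭⇒↭ₛ (↭-sym w↭)) (range-unique lo k)

applyUpTo≡range : ∀ lo k {f : ℕ → ℕ} → (∀ i → f i ≡ lo + i) → applyUpTo f k ≡ range lo k
applyUpTo≡range lo zero f≗ = refl
applyUpTo≡range lo (suc k) f≗ =
  cong₂ _∷_ (trans (f≗ 0) (+-identityʳ lo)) (applyUpTo≡range (suc lo) k (λ i → trans (f≗ (suc i)) (+-suc lo i)))

oneTo≡range : ∀ n → oneTo n ≡ range 1 n
oneTo≡range n = trans (map-applyUpTo id suc n) (applyUpTo≡range 1 n (λ _ → refl))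

-- Halving

Even-suc-suc⁺ : ∀ {n} → Even n → Even (suc (suc n))
Even-suc-suc⁺ (k , refl) = suc k , sym (*-suc 2 k)

Even-suc-suc⁻ : ∀ {n} → Even (suc (suc n)) → Even n
Even-suc-suc⁻ (zero , ())
Even-suc-suc⁻ (suc k , eq) = k , suc-injective (suc-injective (trans eq (*-suc 2 k)))

¬Even-1 : ¬ Even 1
¬Even-1 (k , eq) = even≢odd k 0 (sym eq)

⌊suc/2⌋-by-parity : ∀ m →
  (Even (suc m) × ⌊ suc m /2⌋ ≡ suc ⌊ m /2⌋) ⊎ (¬ Even (suc m) × ⌊ suc m /2⌋ ≡ ⌊ m /2⌋)
⌊suc/2⌋-by-parity zero = inj₂ (¬Even-1 , refl)
⌊suc/2⌋-by-parity (suc zero) = inj₁ ((1 , refl) , refl)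
⌊suc/2⌋-by-parity (suc (suc m)) with ⌊suc/2⌋-by-parity m
... | inj₁ (even , eq) = inj₁ (Even-suc-suc⁺ even , cong suc eq)
... | inj₂ (odd , eq) = inj₂ (odd ∘ Even-suc-suc⁻ , cong suc eq)

⌊n/2⌋≡n/2 : ∀ n → ⌊ n /2⌋ ≡ n / 2
⌊n/2⌋≡n/2 zero = refl
⌊n/2⌋≡n/2 (suc zero) = refl
⌊n/2⌋≡n/2 (suc (suc n)) = trans (cong suc (⌊n/2⌋≡n/2 n)) (sym (m/n≡1+[m∸n]/n {2 + n} {2} (s≤s (s≤s z≤n))))

-- Counting

Image : (List ℕ → List ℕ) → (List ℕ → Set) → List ℕ → Set
Image f P π = ∃ λ w → P w × π ≡ f w

variable
  P Q : List ℕ → Set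

HasCount-resp-⇔ : ∀ {c} → (∀ π → P π ⇔ Q π) → HasCount P c → HasCount Q c
HasCount-resp-⇔ P⇔Q (L , u , ∈⇔P , len) = L , u , (λ π → P⇔Q π ⇔-∘ ∈⇔P π) , len

HasCount-≡ : ∀ π₀ → HasCount (_≡ π₀) 1
HasCount-≡ π₀ = [ π₀ ] , [] ∷ [] , (λ π → mk⇔ (λ { (here eq) → eq ; (there ()) }) here) , refl

HasCount-Image : ∀ {c} (f : List ℕ → List ℕ) → (∀ {v w} → f v ≡ f w → v ≡ w) →
  HasCount P c → HasCount (Image f P) c
HasCount-Image f f-injective (L , u , ∈⇔P , len) =
  map f L ,
  Unique.map⁺ f-injective u ,
  (λ π → mk⇔ (λ π∈ → let w , w∈ , eq = ∈-map⁻ f π∈ in w , Equivalence.to (∈⇔P w) w∈ , eq)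
             (λ { (w , Pw , refl) → ∈-map⁺ f (Equivalence.from (∈⇔P w) Pw) })) ,
  trans (length-map f L) len

HasCount-⊎ : ∀ {a b} → HasCount P a → HasCount Q b → (∀ {π} → P π → ¬ Q π) →
  HasCount (λ π → P π ⊎ Q π) (a + b)
HasCount-⊎ (L , uL , ∈L⇔P , lenL) (M , uM , ∈M⇔Q , lenM) disjoint =
  L ++ M ,
  Unique.++⁺ uL uM (λ (∈L , ∈M) → disjoint (Equivalence.to (∈L⇔P _) ∈L) (Equivalence.to (∈M⇔Q _) ∈M)) ,
  (λ π → (∈L⇔P π ⊎-⇔ ∈M⇔Q π) ⇔-∘ ++-∈⇔) ,
  trans (length-++ L) (cong₂ _+_ lenL lenM)

HasCount-⊎-Even : ∀ m → HasCount P (2 ^ ⌊ m /2⌋) → HasCount Q (2 ^ ⌊ m /2⌋) → (∀ {π} → P π → ¬ Q π) →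
  HasCount (λ π → P π ⊎ (Even (suc m) × Q π)) (2 ^ ⌊ suc m /2⌋)
HasCount-⊎-Even m #P #Q disjoint with ⌊suc/2⌋-by-parity m
... | inj₁ (even , eq) rewrite eq =
  HasCount-resp-⇔ (λ π → mk⇔ (map₂ (even ,_)) (map₂ proj₂))
    (subst (HasCount _) (cong (2 ^ ⌊ m /2⌋ +_) (sym (+-identityʳ _))) (HasCount-⊎ #P #Q disjoint))
... | inj₂ (odd , eq) rewrite eq =
  HasCount-resp-⇔ (λ π → mk⇔ inj₁ λ { (inj₁ Pπ) → Pπ ; (inj₂ (even , _)) → contradiction even odd }) #P

-- Jacobi words

module _ {a p : Level} {A : Set a} {P : A → Set p} (P? : Decidable P) where

  takeWhile-all : ∀ {xs} → All P xs → takeWhile P? xs ≡ xs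
  takeWhile-all [] = refl
  takeWhile-all {x ∷ xs} (px ∷ pxs) with P? x
  ... | yes _ = cong (x ∷_) (takeWhile-all pxs)
  ... | no ¬px = contradiction px ¬px

  takeWhile-++-reject : ∀ {y} xs ys → ¬ P y → takeWhile P? (xs ++ y ∷ ys) ≡ takeWhile P? xs
  takeWhile-++-reject {y} [] ys ¬py with P? y
  ... | yes py = contradiction py ¬py
  ... | no _ = refl
  takeWhile-++-reject (x ∷ xs) ys ¬py with P? x
  ... | yes _ = cong (x ∷_) (takeWhile-++-reject xs ys ¬py)
  ... | no _ = refl

Even-length-cong : ∀ {xs ys : List ℕ} → xs ≡ ys → Even (length xs) ⇔ Even (length ys)
Even-length-cong refl = mk⇔ id id

Jacobi-∷-max : ∀ {x w} → All (_< x) w → Jacobi w → Jacobi (x ∷ w)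
Jacobi-∷-max {w = []} [] jw = (0 , refl) , jw
Jacobi-∷-max {x} {y ∷ w} (y<x ∷ _) jw =
  Equivalence.from (Even-length-cong (takeWhile-++-reject (x <?_) [] w (<-asym y<x))) (0 , refl) , jw

Jacobi-∷-min : ∀ {x w} → All (x <_) w → Jacobi (x ∷ w) ⇔ (Even (length w) × Jacobi w)
Jacobi-∷-min {x} x<w = Even-length-cong (takeWhile-all (x <?_) x<w) ×-⇔ mk⇔ id id

Jacobi-snoc-min : ∀ {y w} → All (y <_) w → Jacobi (w ++ [ y ]) ⇔ Jacobi w
Jacobi-snoc-min [] = mk⇔ _ (λ _ → (0 , refl) , _)
Jacobi-snoc-min {y} {x ∷ w} (y<x ∷ y<w) =
  Even-length-cong (takeWhile-++-reject (x <?_) w [] (<-asym y<x)) ×-⇔ Jacobi-snoc-min y<w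

-- Patterns of length three

Avoids-⊆ : ∀ {π π′ σ} → π′ ⊆ π → Avoids π σ → Avoids π′ σ
Avoids-⊆ π′⊆π av (w , w⊆π′ , so) = av (w , ⊆-trans w⊆π′ π′⊆π , so)

Avoids-shorter : ∀ {π σ} → length π < length σ → Avoids π σ
Avoids-shorter π<σ (w , w⊆π , eq , _) = <-irrefl eq (≤-<-trans (length-mono-≤ w⊆π) π<σ)

pair-⊆ : ∀ {x y : ℕ} {xs} → x ∈ xs → y ∈ xs → x ≢ y → (x ∷ y ∷ []) ⊆ xs ⊎ (y ∷ x ∷ []) ⊆ xs
pair-⊆ (here refl) (here refl) x≢y = contradiction refl x≢y
pair-⊆ (here refl) (there y∈) _ = inj₁ (refl ∷ from∈ y∈)
pair-⊆ (there x∈) (here refl) _ = inj₂ (refl ∷ from∈ x∈)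
pair-⊆ {xs = z ∷ _} (there x∈) (there y∈) x≢y = Data.Sum.map (z ∷ʳ_) (z ∷ʳ_) (pair-⊆ x∈ y∈ x≢y)

⊆-snoc⁻ : ∀ {w : List ℕ} u y → w ⊆ u ++ [ y ] → w ⊆ u ⊎ ∃ λ v → w ≡ v ++ [ y ] × v ⊆ u
⊆-snoc⁻ [] y (.y ∷ʳ w⊆[]) = inj₁ w⊆[]
⊆-snoc⁻ [] y (refl ∷ []) = inj₂ ([] , refl , [])
⊆-snoc⁻ (z ∷ u) y (.z ∷ʳ w⊆) = Data.Sum.map (z ∷ʳ_) (λ (v , eq , v⊆u) → v , eq , z ∷ʳ v⊆u) (⊆-snoc⁻ u y w⊆)
⊆-snoc⁻ (z ∷ u) y (refl ∷ w⊆) with ⊆-snoc⁻ u y w⊆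
... | inj₁ w⊆u = inj₁ (refl ∷ w⊆u)
... | inj₂ (v , refl , v⊆u) = inj₂ (z ∷ v , refl , refl ∷ v⊆u)

Aligned : ℕ → ℕ → ℕ → ℕ → Set
Aligned a b p q = (a < b × p < q) ⊎ (b < a × q < p)

Aligned⇒⇔ : ∀ {a b p q} → Aligned a b p q → (a < b ⇔ p < q)
Aligned⇒⇔ (inj₁ (a<b , p<q)) = mk⇔ (λ _ → p<q) (λ _ → a<b)
Aligned⇒⇔ (inj₂ (b<a , q<p)) = mk⇔ (λ a<b → contradiction a<b (<-asym b<a)) (λ p<q → contradiction p<q (<-asym q<p))

sameOrder₃ : ∀ {a b c p q r} → Aligned a b p q → Aligned a c p r → Aligned b c q r →
  SameOrder (a ∷ b ∷ c ∷ []) (p ∷ q ∷ r ∷ [])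
sameOrder₃ ab ac bc = refl , λ where
    zero zero → irrefl⇔
    zero (suc zero) → Aligned⇒⇔ ab
    zero (suc (suc zero)) → Aligned⇒⇔ ac
    (suc zero) zero → Aligned⇒⇔ (Data.Sum.swap ab)
    (suc zero) (suc zero) → irrefl⇔
    (suc zero) (suc (suc zero)) → Aligned⇒⇔ bc
    (suc (suc zero)) zero → Aligned⇒⇔ (Data.Sum.swap ac)
    (suc (suc zero)) (suc zero) → Aligned⇒⇔ (Data.Sum.swap bc)
    (suc (suc zero)) (suc (suc zero)) → irrefl⇔
  where
  irrefl⇔ : ∀ {x y} → x < x ⇔ y < y
  irrefl⇔ = mk⇔ (λ x<x → contradiction x<x (<-irrefl refl)) (λ y<y → contradiction y<y (<-irrefl refl))

sameOrder⇒< : ∀ {w σ} (so : SameOrder w σ) i j →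
  lookup σ (cast (proj₁ so) i) < lookup σ (cast (proj₁ so) j) → lookup w i < lookup w j
sameOrder⇒< (_ , iff) i j = Equivalence.from (iff i j)

module _ {p q r : ℕ} {w : List ℕ} where

  avoids₃-∷ : ∀ {x} → Avoids w (p ∷ q ∷ r ∷ []) →
    (∀ {b c} → b ∈ w → c ∈ w → ¬ SameOrder (x ∷ b ∷ c ∷ []) (p ∷ q ∷ r ∷ [])) →
    Avoids (x ∷ w) (p ∷ q ∷ r ∷ [])
  avoids₃-∷ av new (v , _ ∷ʳ v⊆w , so) = av (v , v⊆w , so)
  avoids₃-∷ av new (_ ∷ _ ∷ _ ∷ [] , refl ∷ bc⊆w , so) =
    new (Sublist.lookup bc⊆w (here refl)) (Sublist.lookup bc⊆w (there (here refl))) so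
  avoids₃-∷ av new (_ ∷ [] , refl ∷ _ , () , _)
  avoids₃-∷ av new (_ ∷ _ ∷ [] , refl ∷ _ , () , _)
  avoids₃-∷ av new (_ ∷ _ ∷ _ ∷ _ ∷ _ , refl ∷ _ , () , _)

  avoids₃-snoc : ∀ {y} → Avoids w (p ∷ q ∷ r ∷ []) →
    (∀ {a b} → a ∈ w → b ∈ w → ¬ SameOrder (a ∷ b ∷ y ∷ []) (p ∷ q ∷ r ∷ [])) →
    Avoids (w ++ [ y ]) (p ∷ q ∷ r ∷ [])
  avoids₃-snoc {y} av new (v , v⊆ , so) with ⊆-snoc⁻ w y v⊆ | so
  ... | inj₁ v⊆w | _ = av (v , v⊆w , so)
  ... | inj₂ (_ ∷ _ ∷ [] , refl , ab⊆w) | _ =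
    new (Sublist.lookup ab⊆w (here refl)) (Sublist.lookup ab⊆w (there (here refl))) so
  ... | inj₂ ([] , refl , _) | () , _
  ... | inj₂ (_ ∷ [] , refl , _) | () , _
  ... | inj₂ (_ ∷ _ ∷ _ ∷ [] , refl , _) | () , _
  ... | inj₂ (_ ∷ _ ∷ _ ∷ _ ∷ _ , refl , _) | () , _

  avoids₃-∷-max : ∀ {x} → p < q ⊎ p < r → All (_< x) w →
    Avoids w (p ∷ q ∷ r ∷ []) → Avoids (x ∷ w) (p ∷ q ∷ r ∷ [])
  avoids₃-∷-max (inj₁ p<q) w<x av =
    avoids₃-∷ av λ b∈ _ so → <-asym (sameOrder⇒< so (# 0) (# 1) p<q) (All.lookup w<x b∈)
  avoids₃-∷-max (inj₂ p<r) w<x av =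
    avoids₃-∷ av λ _ c∈ so → <-asym (sameOrder⇒< so (# 0) (# 2) p<r) (All.lookup w<x c∈)

  avoids₃-∷-min : ∀ {x} → q < p ⊎ r < p → All (x <_) w →
    Avoids w (p ∷ q ∷ r ∷ []) → Avoids (x ∷ w) (p ∷ q ∷ r ∷ [])
  avoids₃-∷-min (inj₁ q<p) x<w av =
    avoids₃-∷ av λ b∈ _ so → <-asym (sameOrder⇒< so (# 1) (# 0) q<p) (All.lookup x<w b∈)
  avoids₃-∷-min (inj₂ r<p) x<w av =
    avoids₃-∷ av λ _ c∈ so → <-asym (sameOrder⇒< so (# 2) (# 0) r<p) (All.lookup x<w c∈)

  avoids₃-snoc-min : ∀ {y} → p < r ⊎ q < r → All (y <_) w →
    Avoids w (p ∷ q ∷ r ∷ []) → Avoids (w ++ [ y ]) (p ∷ q ∷ r ∷ [])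
  avoids₃-snoc-min (inj₁ p<r) y<w av =
    avoids₃-snoc av λ a∈ _ so → <-asym (sameOrder⇒< so (# 0) (# 2) p<r) (All.lookup y<w a∈)
  avoids₃-snoc-min (inj₂ q<r) y<w av =
    avoids₃-snoc av λ _ b∈ so → <-asym (sameOrder⇒< so (# 1) (# 2) q<r) (All.lookup y<w b∈)

σ₂₁₃ σ₂₃₁ σ₃₁₂ : List ℕ
σ₂₁₃ = 2 ∷ 1 ∷ 3 ∷ []
σ₂₃₁ = 2 ∷ 3 ∷ 1 ∷ []
σ₃₁₂ = 3 ∷ 1 ∷ 2 ∷ []

1<2 : 1 < 2
1<2 = s<s z<s

1<3 : 1 < 3
1<3 = s<s z<s

2<3 : 2 < 3
2<3 = s<s (s<s z<s)

sameOrder-213 : ∀ {a b c} → b < a → a < c → SameOrder (a ∷ b ∷ c ∷ []) σ₂₁₃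
sameOrder-213 b<a a<c = sameOrder₃ (inj₂ (b<a , 1<2)) (inj₁ (a<c , 2<3)) (inj₁ (<-trans b<a a<c , 1<3))

sameOrder-231 : ∀ {a b c} → c < a → a < b → SameOrder (a ∷ b ∷ c ∷ []) σ₂₃₁
sameOrder-231 c<a a<b = sameOrder₃ (inj₁ (a<b , 2<3)) (inj₂ (c<a , 1<2)) (inj₂ (<-trans c<a a<b , 1<3))

sameOrder-312 : ∀ {a b c} → b < c → c < a → SameOrder (a ∷ b ∷ c ∷ []) σ₃₁₂
sameOrder-312 b<c c<a = sameOrder₃ (inj₂ (<-trans b<c c<a , 1<3)) (inj₂ (c<a , 2<3)) (inj₁ (b<c , 1<2))

interior-first-letter : ∀ {x w lo hi} → lo < x → x < hi → lo ∈ w → hi ∈ w →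
  Contains (x ∷ w) σ₂₁₃ ⊎ Contains (x ∷ w) σ₂₃₁
interior-first-letter lo<x x<hi lo∈ hi∈ with pair-⊆ lo∈ hi∈ (<⇒≢ (<-trans lo<x x<hi))
... | inj₁ lo,hi⊆w = inj₁ (_ , refl ∷ lo,hi⊆w , sameOrder-213 lo<x x<hi)
... | inj₂ hi,lo⊆w = inj₂ (_ , refl ∷ hi,lo⊆w , sameOrder-231 lo<x x<hi)

interior-minimum : ∀ {a lo c π} → (a ∷ lo ∷ c ∷ []) ⊆ π → lo < a → lo < c → a ≢ c →
  Contains π σ₂₁₃ ⊎ Contains π σ₃₁₂
interior-minimum {a} {c = c} a,lo,c⊆π lo<a lo<c a≢c with <-cmp a c
... | tri< a<c _ _ = inj₁ (_ , a,lo,c⊆π , sameOrder-213 lo<a a<c)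
... | tri≈ _ a≡c _ = contradiction a≡c a≢c
... | tri> _ _ c<a = inj₂ (_ , a,lo,c⊆π , sameOrder-312 lo<c c<a)

-- Jacobi permutations of an interval avoiding 213

JacobiAvoiding2On : List ℕ → List ℕ → List ℕ → List ℕ → Set
JacobiAvoiding2On S τ σ π = π ↭ S × Jacobi π × Avoids π τ × Avoids π σ

JacobiAvoiding213 : List ℕ → ℕ → ℕ → List ℕ → Set
JacobiAvoiding213 σ lo k = JacobiAvoiding2On (range lo k) σ₂₁₃ σ

JacobiAvoiding213-singleton : ∀ {σ lo π} → 1 < length σ → JacobiAvoiding213 σ lo 1 π ⇔ π ≡ [ lo ]
JacobiAvoiding213-singleton {σ} 1<σ = mk⇔ (↭-singleton-inv ∘ proj₁)
  λ { refl → ↭-refl , ((0 , refl) , _) , Avoids-shorter {σ = σ₂₁₃} 1<3 , Avoids-shorter {σ = σ} 1<σ }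

module _ {p q r lo m : ℕ} {w : List ℕ} where

  JacobiAvoiding213-∷-max : p < q ⊎ p < r →
    JacobiAvoiding213 (p ∷ q ∷ r ∷ []) lo (2 + m) ((lo + suc m) ∷ w) ⇔
    JacobiAvoiding213 (p ∷ q ∷ r ∷ []) lo (suc m) w
  JacobiAvoiding213-∷-max first≢max = mk⇔
    (λ (↭range , (_ , jw) , av₂₁₃ , avσ) →
      drop-∷ (↭-trans ↭range (range-suc↭ lo (suc m))) , jw ,
      Avoids-⊆ (_ ∷ʳ ⊆-refl) av₂₁₃ , Avoids-⊆ (_ ∷ʳ ⊆-refl) avσ)
    (λ (w↭ , jw , av₂₁₃ , avσ) →
      ↭-trans (prep _ w↭) (↭-sym (range-suc↭ lo (suc m))) , Jacobi-∷-max (↭-range-upper w↭) jw ,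
      avoids₃-∷-max (inj₂ 2<3) (↭-range-upper w↭) av₂₁₃ , avoids₃-∷-max first≢max (↭-range-upper w↭) avσ)

  JacobiAvoiding213-∷-min : q < p ⊎ r < p →
    JacobiAvoiding213 (p ∷ q ∷ r ∷ []) lo (2 + m) (lo ∷ w) ⇔
    (Even (suc m) × JacobiAvoiding213 (p ∷ q ∷ r ∷ []) (suc lo) (suc m) w)
  JacobiAvoiding213-∷-min first≢min = mk⇔
    (λ (↭range , jlw , av₂₁₃ , avσ) →
      let w↭ = drop-∷ ↭range ; even , jw = Equivalence.to (Jacobi-∷-min (↭-range-lower w↭)) jlw in
      subst Even (length-↭-range w↭) even , w↭ , jw ,
      Avoids-⊆ (_ ∷ʳ ⊆-refl) av₂₁₃ , Avoids-⊆ (_ ∷ʳ ⊆-refl) avσ)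
    (λ (even , w↭ , jw , av₂₁₃ , avσ) →
      prep lo w↭ ,
      Equivalence.from (Jacobi-∷-min (↭-range-lower w↭)) (subst Even (sym (length-↭-range w↭)) even , jw) ,
      avoids₃-∷-min (inj₁ 1<2) (↭-range-lower w↭) av₂₁₃ , avoids₃-∷-min first≢min (↭-range-lower w↭) avσ)

  JacobiAvoiding213-snoc-min : p < r ⊎ q < r →
    JacobiAvoiding213 (p ∷ q ∷ r ∷ []) lo (2 + m) (w ++ [ lo ]) ⇔
    JacobiAvoiding213 (p ∷ q ∷ r ∷ []) (suc lo) (suc m) w
  JacobiAvoiding213-snoc-min last≢min = mk⇔
    (λ (↭range , jwl , av₂₁₃ , avσ) → let w↭ = drop-∷ (↭-trans (∷↭∷ʳ lo w) ↭range) in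
      w↭ , Equivalence.to (Jacobi-snoc-min (↭-range-lower w↭)) jwl ,
      Avoids-⊆ (++⁺ʳ _ ⊆-refl) av₂₁₃ , Avoids-⊆ (++⁺ʳ _ ⊆-refl) avσ)
    (λ (w↭ , jw , av₂₁₃ , avσ) →
      ↭-trans (↭-sym (∷↭∷ʳ lo w)) (prep lo w↭) , Equivalence.from (Jacobi-snoc-min (↭-range-lower w↭)) jw ,
      avoids₃-snoc-min (inj₂ 1<3) (↭-range-lower w↭) av₂₁₃ , avoids₃-snoc-min last≢min (↭-range-lower w↭) avσ)

module _ {lo m : ℕ} where

  first-letter-213-231-avoider : ∀ {x w} → x ∷ w ↭ range lo (2 + m) →
    Avoids (x ∷ w) σ₂₁₃ → Avoids (x ∷ w) σ₂₃₁ → x ≡ lo ⊎ x ≡ lo + suc m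
  first-letter-213-231-avoider {x} {w} ↭range av₂₁₃ av₂₃₁ with x ≟ lo | x ≟ lo + suc m
  ... | yes x≡lo | _ = inj₁ x≡lo
  ... | no _ | yes x≡hi = inj₂ x≡hi
  ... | no x≢lo | no x≢hi = contradiction
    (interior-first-letter (≤∧≢⇒< lo≤x (x≢lo ∘ sym)) (≤∧≢⇒< x≤hi x≢hi)
                           (tail (x≢lo ∘ sym) lo∈) (tail (x≢hi ∘ sym) hi∈))
    Data.Sum.[ av₂₁₃ , av₂₃₁ ]
    where
    lo≤x : lo ≤ x
    lo≤x = proj₁ (∈-↭-range⁻ ↭range (here refl))
    x≤hi : x ≤ lo + suc m
    x≤hi = ≤-pred (subst (x <_) (+-suc lo (suc m)) (proj₂ (∈-↭-range⁻ ↭range (here refl))))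
    lo∈ : lo ∈ x ∷ w
    lo∈ = ∈-resp-↭ (↭-sym ↭range) (here refl)
    hi∈ : lo + suc m ∈ x ∷ w
    hi∈ = ∈-resp-↭ (↭-sym (↭-trans ↭range (range-suc↭ lo (suc m)))) (here refl)

  minimum-213-312-avoider : ∀ {π} → π ↭ range lo (2 + m) → Avoids π σ₂₁₃ → Avoids π σ₃₁₂ →
    (∃ λ w → π ≡ lo ∷ w) ⊎ (∃ λ w → π ≡ w ++ [ lo ])
  minimum-213-312-avoider ↭range av₂₁₃ av₃₁₂ with ∈-∃++ (∈-resp-↭ (↭-sym ↭range) (here refl))
  ... | [] , v , refl = inj₁ (v , refl)
  ... | u , [] , refl = inj₂ (u , refl)
  ... | a ∷ u , c ∷ v , refl = contradiction
    (interior-minimum (refl ∷ ++⁺ˡ u (refl ∷ refl ∷ []⊆-universal v))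
                      (lo< (here refl)) (lo< (∈-++⁺ʳ (a ∷ u) (here refl))) a≢c)
    Data.Sum.[ av₂₁₃ , av₃₁₂ ]
    where
    rest↭ : a ∷ u ++ c ∷ v ↭ range (suc lo) (suc m)
    rest↭ = drop-mid (a ∷ u) [] ↭range
    lo< : ∀ {z} → z ∈ a ∷ u ++ c ∷ v → lo < z
    lo< = proj₁ ∘ ∈-↭-range⁻ rest↭
    a≢c : a ≢ c
    a≢c = case unique-↭-range rest↭ of λ { (a∉ ∷ _) → All.lookup a∉ (∈-++⁺ʳ u (here refl)) }

  JacobiAvoiding213-231-split : ∀ {π} → JacobiAvoiding213 σ₂₃₁ lo (2 + m) π ⇔
    (Image ((lo + suc m) ∷_) (JacobiAvoiding213 σ₂₃₁ lo (suc m)) π ⊎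
     (Even (suc m) × Image (lo ∷_) (JacobiAvoiding213 σ₂₃₁ (suc lo) (suc m)) π))
  JacobiAvoiding213-231-split = mk⇔ split join
    where
    Below Above : List ℕ → Set
    Below = JacobiAvoiding213 σ₂₃₁ lo (suc m)
    Above = JacobiAvoiding213 σ₂₃₁ (suc lo) (suc m)
    split : ∀ {π} → JacobiAvoiding213 σ₂₃₁ lo (2 + m) π →
      Image ((lo + suc m) ∷_) Below π ⊎ (Even (suc m) × Image (lo ∷_) Above π)
    split {[]} (↭range , _) = contradiction (↭-length ↭range) λ ()
    split {x ∷ w} J@(↭range , _ , av₂₁₃ , av₂₃₁) with first-letter-213-231-avoider ↭range av₂₁₃ av₂₃₁
    ... | inj₁ refl =
      let even , Jw = Equivalence.to (JacobiAvoiding213-∷-min (inj₂ 1<2)) J in inj₂ (even , w , Jw , refl)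
    ... | inj₂ refl = inj₁ (w , Equivalence.to (JacobiAvoiding213-∷-max (inj₁ 2<3)) J , refl)
    join : ∀ {π} → Image ((lo + suc m) ∷_) Below π ⊎ (Even (suc m) × Image (lo ∷_) Above π) →
      JacobiAvoiding213 σ₂₃₁ lo (2 + m) π
    join (inj₁ (w , Jw , refl)) = Equivalence.from (JacobiAvoiding213-∷-max (inj₁ 2<3)) Jw
    join (inj₂ (even , w , Jw , refl)) = Equivalence.from (JacobiAvoiding213-∷-min (inj₂ 1<2)) (even , Jw)

  JacobiAvoiding213-312-split : ∀ {π} → JacobiAvoiding213 σ₃₁₂ lo (2 + m) π ⇔
    (Image (_++ [ lo ]) (JacobiAvoiding213 σ₃₁₂ (suc lo) (suc m)) π ⊎
     (Even (suc m) × Image (lo ∷_) (JacobiAvoiding213 σ₃₁₂ (suc lo) (suc m)) π))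
  JacobiAvoiding213-312-split = mk⇔ split join
    where
    Above : List ℕ → Set
    Above = JacobiAvoiding213 σ₃₁₂ (suc lo) (suc m)
    split : ∀ {π} → JacobiAvoiding213 σ₃₁₂ lo (2 + m) π →
      Image (_++ [ lo ]) Above π ⊎ (Even (suc m) × Image (lo ∷_) Above π)
    split J@(↭range , _ , av₂₁₃ , av₃₁₂) with minimum-213-312-avoider ↭range av₂₁₃ av₃₁₂
    ... | inj₁ (w , refl) =
      let even , Jw = Equivalence.to (JacobiAvoiding213-∷-min (inj₁ 1<3)) J in inj₂ (even , w , Jw , refl)
    ... | inj₂ (w , refl) = inj₁ (w , Equivalence.to (JacobiAvoiding213-snoc-min (inj₂ 1<2)) J , refl)
    join : ∀ {π} → Image (_++ [ lo ]) Above π ⊎ (Even (suc m) × Image (lo ∷_) Above π) →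
      JacobiAvoiding213 σ₃₁₂ lo (2 + m) π
    join (inj₁ (w , Jw , refl)) = Equivalence.from (JacobiAvoiding213-snoc-min (inj₂ 1<2)) Jw
    join (inj₂ (even , w , Jw , refl)) = Equivalence.from (JacobiAvoiding213-∷-min (inj₁ 1<3)) (even , Jw)

count-231 : ∀ m lo → HasCount (JacobiAvoiding213 σ₂₃₁ lo (suc m)) (2 ^ ⌊ m /2⌋)
count-231 zero lo = HasCount-resp-⇔ (λ _ → ⇔-sym (JacobiAvoiding213-singleton 1<3)) (HasCount-≡ [ lo ])
count-231 (suc m) lo = HasCount-resp-⇔ (λ _ → ⇔-sym JacobiAvoiding213-231-split)
  (HasCount-⊎-Even m (HasCount-Image _ ∷-injectiveʳ (count-231 m lo))
                     (HasCount-Image _ ∷-injectiveʳ (count-231 m (suc lo)))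
    λ { (_ , _ , refl) (_ , _ , hi∷≡lo∷) → m+1+n≢m lo (∷-injectiveˡ hi∷≡lo∷) })

count-312 : ∀ m lo → HasCount (JacobiAvoiding213 σ₃₁₂ lo (suc m)) (2 ^ ⌊ m /2⌋)
count-312 zero lo = HasCount-resp-⇔ (λ _ → ⇔-sym (JacobiAvoiding213-singleton 1<3)) (HasCount-≡ [ lo ])
count-312 (suc m) lo = HasCount-resp-⇔ (λ _ → ⇔-sym JacobiAvoiding213-312-split)
  (HasCount-⊎-Even m (HasCount-Image _ (++-cancelʳ [ lo ] _ _) (count-312 m (suc lo)))
                     (HasCount-Image _ ∷-injectiveʳ (count-312 m (suc lo)))
    λ { (w , (w↭ , _) , refl) (_ , _ , w++lo≡lo∷) → lo-not-first w↭ w++lo≡lo∷ })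
  where
  lo-not-first : ∀ {w v} → w ↭ range (suc lo) (suc m) → w ++ [ lo ] ≢ lo ∷ v
  lo-not-first {[]} w↭ _ = contradiction (↭-length w↭) λ ()
  lo-not-first {a ∷ _} w↭ eq = <⇒≢ (proj₁ (∈-↭-range⁻ w↭ (here refl))) (sym (∷-injectiveˡ eq))

theorem8p6 : (n : ℕ) → n ≥ 1 → (σ : List ℕ) →
    (σ ≡ 2 ∷ 3 ∷ 1 ∷ [] ⊎ σ ≡ 3 ∷ 1 ∷ 2 ∷ []) →
    HasCount (JacobiAvoiding2 n (2 ∷ 1 ∷ 3 ∷ []) σ) (2 ^ ((n ∸ 1) / 2))
theorem8p6 zero () _ _
theorem8p6 (suc m) _ σ σ∈ =
  subst₂ (λ S c → HasCount (JacobiAvoiding2On S σ₂₁₃ σ) c)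
    (sym (oneTo≡range (suc m))) (cong (2 ^_) (⌊n/2⌋≡n/2 m)) (count σ∈)
  where
  count : σ ≡ σ₂₃₁ ⊎ σ ≡ σ₃₁₂ → HasCount (JacobiAvoiding213 σ 1 (suc m)) (2 ^ ⌊ m /2⌋)
  count (inj₁ refl) = count-231 m 1
  count (inj₂ refl) = count-312 m 1
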